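{- Let $n\geq 2$. The $n$-dimensional augmented cube $AQ_n$ contains at least $$f(n)=1+\sum_{1\leq k\leq n-1}\ \sum_{2\leq j_1<j_2<\cdots<j_k\leq n}(j_k-j_{k-1})\cdots(j_2-j_1)\,j_1$$ distinct subgraphs that are isomorphic to the $n$-dimensional hypercube $Q_n$. (For $k=1$ the product in the summand is just $j_1$.)
   Context: The $n$-dimensional hypercube $Q_n$ has vertex set $\{0,1\}^n$ (strings $x_n x_{n-1}\cdots x_1$), two vertices being adjacent iff they differ in exactly one bit. The $n$-dimensional augmented cube $AQ_n$ has the same vertex set $\{0,1\}^n$, and $u=u_n\cdots u_1$ is adjacent to $v=v_n\cdots v_1$ iff either (i) there is $i\in\{1,\dots,n\}$ with $v_i=u_i+1 \pmod 2$ and $v_l=u_l$ for $l\neq i$ (a hypercube edge of dimension $i$), or (ii) there is $j\in\{2,\dots,n\}$ with $v_l=u_l+1\pmod 2$ for all $l\leq j$ and $v_l=u_l$ for all $l>j$ (an augmented edge of dimension $j$). Thus $AQ_n$ is $(2n-1)$-regular and contains $Q_n$ as a spanning subgraph. Two subgraphs are distinct if they differ as subgraphs (here, equivalently, in their edge sets). -}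

module Defs where

open import Data.Nat using (ℕ; zero; suc; _+_; _*_; _∸_; _≤_; _<ᵇ_)
open import Data.Bool using (Bool; not; if_then_else_)
open import Data.Fin using (Fin; toℕ)
open import Data.Vec using (Vec; lookup; tabulate)
open import Data.List using (List; []; _∷_; _++_; map; upTo)
open import Data.Nat.ListAction using (sum)
open import Data.Product using (Σ; ∃; ∃-syntax; _×_; _,_)
open import Data.Sum using (_⊎_)
open import Relation.Binary.PropositionalEquality using (_≡_; _≢_)
open import Relation.Nullary using (¬_)
open import Function.Bundles using (_⇔_)
open import Function.Definitions using (Injective)

-- Vertices of Q_n / AQ_n: bit strings of length n.
-- Convention: position l : Fin n of the vector holds the bit x_{toℕ l + 1},
-- so position 0 is x_1 and position n-1 is x_n.
Vertex : ℕ → Set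
Vertex n = Vec Bool n

flipAt : ∀ {n} → Fin n → Vertex n → Vertex n
flipAt i u = tabulate λ l → if toℕ l Data.Nat.≡ᵇ toℕ i then not (lookup u l) else lookup u l

-- flip all bits x_l with l ≤ j, i.e. positions with toℕ position < j
flipLow : ∀ {n} → ℕ → Vertex n → Vertex n
flipLow j u = tabulate λ l → if toℕ l <ᵇ j then not (lookup u l) else lookup u l

QAdj : ∀ n → Vertex n → Vertex n → Set
QAdj n u v = ∃[ i ] v ≡ flipAt i u

AugAdj : ∀ n → Vertex n → Vertex n → Set
AugAdj n u v = ∃[ j ] (2 ≤ j × j ≤ n × v ≡ flipLow j u)

AQAdj : ∀ n → Vertex n → Vertex n → Set
AQAdj n u v = QAdj n u v ⊎ AugAdj n u v

-- A subgraph of AQ_n isomorphic to Q_n, presented as an injective,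
-- edge-preserving map φ : V(Q_n) → V(AQ_n); the subgraph is its image
-- (vertex set φ(V), edge set φ(E(Q_n))), which is isomorphic to Q_n via φ.
-- Every subgraph isomorphic to Q_n arises this way.
record QnCopy (n : ℕ) : Set where
  field
    φ     : Vertex n → Vertex n
    inj   : Injective _≡_ _≡_ φ
    edges : ∀ u v → QAdj n u v → AQAdj n (φ u) (φ v)

open QnCopy public

ImgEdge : ∀ {n} → QnCopy n → Vertex n → Vertex n → Set
ImgEdge {n} c a b = ∃[ u ] ∃[ v ] (QAdj n u v × φ c u ≡ a × φ c v ≡ b)

-- two copies are distinct subgraphs: their edge sets differ
-- (their vertex sets are always all of {0,1}^n, by injectivity)
DistinctSubgraphs : ∀ {n} → QnCopy n → QnCopy n → Set
DistinctSubgraphs c d = ¬ (∀ a b → ImgEdge c a b ⇔ ImgEdge d a b)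

sublists : List ℕ → List (List ℕ)
sublists [] = [] ∷ []
sublists (x ∷ xs) = sublists xs ++ map (x ∷_) (sublists xs)

diffProd : List ℕ → ℕ
diffProd [] = 1
diffProd (a ∷ []) = 1
diffProd (a ∷ b ∷ r) = (b ∸ a) * diffProd (b ∷ r)

-- summand (j_k - j_{k-1}) ⋯ (j_2 - j_1) j_1 ; the empty chain (k = 0) contributes 0
term : List ℕ → ℕ
term [] = 0
term (j₁ ∷ r) = diffProd (j₁ ∷ r) * j₁

from2 : ℕ → List ℕ
from2 n = map (λ i → i + 2) (upTo (n ∸ 1))

-- f(n) = 1 + Σ over nonempty increasing chains 2 ≤ j_1 < ... < j_k ≤ n
-- (such chains automatically have 1 ≤ k ≤ n-1)
f : ℕ → ℕ
f n = 1 + sum (map term (sublists (from2 n)))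

{-# OPTIONS --safe #-}
-- Number the bit positions 0, …, n-1, let e_k flip position k and a_j flip the
-- positions below j (the augmented direction of dimension j).  For a chain
-- (r₁ , j₁) … (r_k , j_k) with r₁ < j₁ ≤ r₂ < j₂ ≤ … ≤ n, compose the linear
-- involutions y ↦ y + y_r (e_r + a_j).  The composite sends e_{r_i} to a_{j_i} and
-- fixes every other e_k, so it embeds Q_n into AQ_n with edge directions
-- {a_{j_i}} ∪ {e_k | k ≠ r_i}.  These directions recover the starts r_i and the
-- ends j_i, so different chains give different subgraphs.  For fixed
-- 2 ≤ j₁ < … < j_k ≤ n there are j₁ (j₂ - j₁) ⋯ (j_k - j_{k-1}) choices of the
-- r_i, and the empty chain gives Q_n itself: f(n) chains in all.
module Submission where

open import Defs
open import Function using (_∘_)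
open import Function.Bundles using (Equivalence)
open import Function.Properties.Equivalence using () renaming (sym to ⇔-sym)
open import Data.Empty using (⊥-elim)
open import Data.Bool using (Bool; true; false; not; if_then_else_; _xor_; _∧_)
open import Data.Bool.Properties
  using (T-≡; ¬-not; not-¬; not-involutive; xor-assoc; xor-comm; xor-identityʳ; ∧-distribʳ-xor; ∧-zeroʳ)
open import Data.Nat using (ℕ; zero; suc; _+_; _*_; _∸_; _≤_; _<_; _≡ᵇ_; _<ᵇ_; s≤s; z≤n)
open import Data.Nat.Properties
  using (≡ᵇ⇒≡; ≡⇒≡ᵇ; <ᵇ⇒<; <⇒<ᵇ; ≤⇒≯; <⇒≱; <⇒≢; <-irrefl; <-cmp; ≤-refl; ≤-trans; <⇒≤;
         <-≤-trans; ≤-<-trans; m≤m+n; m≤n+m; +-comm; +-monoʳ-<; +-monoˡ-<; *-comm; *-zeroʳ; *-distribˡ-+)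
open import Data.Fin using (Fin; zero; suc; toℕ; fromℕ<)
open import Data.Fin.Properties using (toℕ-fromℕ<; toℕ<n)
open import Data.Vec using ([]; _∷_; lookup; tabulate; replicate)
open import Data.Vec.Properties using (lookup∘tabulate; tabulate∘lookup; tabulate-cong)
open import Data.List as List using (List; []; _∷_; _++_; concatMap; applyUpTo; length)
open import Data.List.Properties using (map-++; map-∘; map-cong; length-++; length-map; length-applyUpTo)
open import Data.Nat.ListAction using (sum)
open import Data.Nat.ListAction.Properties using (sum-++)
open import Data.List.Relation.Unary.All as All using (All; []; _∷_)
import Data.List.Relation.Unary.All.Properties as All
open import Data.List.Relation.Unary.AllPairs as AllPairs using (AllPairs; []; _∷_)
import Data.List.Relation.Unary.AllPairs.Properties as AllPairs
open import Data.List.Relation.Unary.Any using (here; there)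
open import Data.List.Membership.Propositional using (_∈_; _∉_)
open import Data.List.Membership.Propositional.Properties using (∈-map⁺; ∈-map⁻; ∈-lookup)
open import Data.Product using (Σ; _×_; _,_; ∃-syntax; proj₁; proj₂)
open import Data.Sum using (_⊎_; inj₁; inj₂; swap) renaming (map to ⊎-map)
open import Relation.Binary using (Symmetric; tri<; tri≈; tri>)
open import Relation.Binary.PropositionalEquality
  using (_≡_; _≢_; refl; sym; trans; cong; cong₂; subst; _≗_; module ≡-Reasoning)
open import Relation.Nullary using (¬_; contradiction)

open ≡-Reasoning

≡ᵇ-refl : ∀ m → (m ≡ᵇ m) ≡ true
≡ᵇ-refl m = Equivalence.to T-≡ (≡⇒≡ᵇ m m refl)

≡ᵇ-true⇒≡ : ∀ {m n} → (m ≡ᵇ n) ≡ true → m ≡ n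
≡ᵇ-true⇒≡ {m} {n} = ≡ᵇ⇒≡ m n ∘ Equivalence.from T-≡

≢⇒≡ᵇ-false : ∀ {m n} → m ≢ n → (m ≡ᵇ n) ≡ false
≢⇒≡ᵇ-false m≢n = ¬-not (m≢n ∘ ≡ᵇ-true⇒≡)

≡ᵇ-false⇒≢ : ∀ {m n} → (m ≡ᵇ n) ≡ false → m ≢ n
≡ᵇ-false⇒≢ {m} eq refl = contradiction (trans (sym (≡ᵇ-refl m)) eq) λ ()

<⇒<ᵇ-true : ∀ {m n} → m < n → (m <ᵇ n) ≡ true
<⇒<ᵇ-true = Equivalence.to T-≡ ∘ <⇒<ᵇ

≤⇒<ᵇ-false : ∀ {m n} → n ≤ m → (m <ᵇ n) ≡ false
≤⇒<ᵇ-false {m} {n} n≤m = ¬-not (≤⇒≯ n≤m ∘ <ᵇ⇒< m n ∘ Equivalence.from T-≡)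

m<n∸o⇒o+m<n : ∀ o n {m} → m < n ∸ o → o + m < n
m<n∸o⇒o+m<n zero    n       m<n   = m<n
m<n∸o⇒o+m<n (suc o) (suc n) m<n∸o = s≤s (m<n∸o⇒o+m<n o n m<n∸o)
m<n∸o⇒o+m<n (suc o) zero    ()

xor-cancelˡ : ∀ x y → x xor (x xor y) ≡ y
xor-cancelˡ true  y = not-involutive y
xor-cancelˡ false y = refl

xor-cancelʳ : ∀ x y z → x xor z ≡ y xor z → x ≡ y
xor-cancelʳ true  true  z eq = refl
xor-cancelʳ false false z eq = refl
xor-cancelʳ true  false z eq = contradiction (sym eq) (not-¬ refl)
xor-cancelʳ false true  z eq = contradiction eq (not-¬ refl)

AllPairs-with : ∀ {A : Set} {P : A → Set} {R : A → A → Set} {xs} →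
  All P xs → AllPairs R xs → AllPairs (λ x y → P x × P y × R x y) xs
AllPairs-with []         []         = []
AllPairs-with (px ∷ pxs) (rx ∷ rxs) = All.zipWith (λ (py , r) → px , py , r) (pxs , rx) ∷ AllPairs-with pxs rxs

AllPairs-lookup : ∀ {A : Set} {R : A → A → Set} → Symmetric R → ∀ {xs} → AllPairs R xs →
  ∀ {i j} → i ≢ j → R (List.lookup xs i) (List.lookup xs j)
AllPairs-lookup R-sym (rx ∷ rxs) {zero}  {zero}  i≢j = contradiction refl i≢j
AllPairs-lookup R-sym (rx ∷ rxs) {zero}  {suc j} i≢j = All.lookup rx (∈-lookup j)
AllPairs-lookup R-sym (rx ∷ rxs) {suc i} {zero}  i≢j = R-sym (All.lookup rx (∈-lookup i))
AllPairs-lookup R-sym (rx ∷ rxs) {suc i} {suc j} i≢j = AllPairs-lookup R-sym rxs (i≢j ∘ cong suc)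

sum-map-*ˡ : ∀ {A : Set} c (h : A → ℕ) ls → sum (List.map (λ s → c * h s) ls) ≡ c * sum (List.map h ls)
sum-map-*ˡ c h []       = sym (*-zeroʳ c)
sum-map-*ˡ c h (s ∷ ls) = trans (cong (c * h s +_) (sum-map-*ˡ c h ls)) (sym (*-distribˡ-+ c (h s) _))

Mask : Set
Mask = ℕ → Bool

infixl 6 _⊕_
infixr 5 _⊕ᵥ_
infix  7 _·_

_⊕_ : Mask → Mask → Mask
(A ⊕ B) p = A p xor B p

_·_ : Bool → Mask → Mask
(b · C) p = b ∧ C p

unit : ℕ → Mask
unit k p = p ≡ᵇ k

low : ℕ → Mask
low j p = p <ᵇ j

_⊕ᵥ_ : ∀ {n} → Mask → Vertex n → Vertex n
A ⊕ᵥ u = tabulate λ l → A (toℕ l) xor lookup u l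

⊕ᵥ-cong : ∀ {n} {A B : Mask} → A ≗ B → (u : Vertex n) → A ⊕ᵥ u ≡ B ⊕ᵥ u
⊕ᵥ-cong A≗B u = tabulate-cong λ l → cong (_xor lookup u l) (A≗B (toℕ l))

⊕ᵥ-assoc : ∀ {n} (A B : Mask) (u : Vertex n) → A ⊕ᵥ B ⊕ᵥ u ≡ (A ⊕ B) ⊕ᵥ u
⊕ᵥ-assoc A B u = tabulate-cong λ l →
  trans (cong (A (toℕ l) xor_) (lookup∘tabulate _ l)) (sym (xor-assoc (A (toℕ l)) (B (toℕ l)) (lookup u l)))

⊕ᵥ-involutive : ∀ {n} (A : Mask) (u : Vertex n) → A ⊕ᵥ A ⊕ᵥ u ≡ u
⊕ᵥ-involutive A u = trans
  (tabulate-cong λ l → trans (cong (A (toℕ l) xor_) (lookup∘tabulate _ l)) (xor-cancelˡ (A (toℕ l)) (lookup u l)))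
  (tabulate∘lookup u)

⊕ᵥ-cancelʳ : ∀ {n} (A B : Mask) (u : Vertex n) → A ⊕ᵥ u ≡ B ⊕ᵥ u → ∀ {p} → p < n → A p ≡ B p
⊕ᵥ-cancelʳ A B u eq {p} p<n =
  subst (λ q → A q ≡ B q) (toℕ-fromℕ< p<n)
    (xor-cancelʳ _ _ (lookup u l)
      (trans (sym (lookup∘tabulate _ l)) (trans (cong (λ w → lookup w l) eq) (lookup∘tabulate _ l))))
  where l = fromℕ< p<n

if-not≡xor : ∀ c b → (if c then not b else b) ≡ c xor b
if-not≡xor true  b = refl
if-not≡xor false b = refl

flipAt≡unit⊕ᵥ : ∀ {n} (i : Fin n) (u : Vertex n) → flipAt i u ≡ unit (toℕ i) ⊕ᵥ u
flipAt≡unit⊕ᵥ i u = tabulate-cong λ l → if-not≡xor (toℕ l ≡ᵇ toℕ i) (lookup u l)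

flipLow≡low⊕ᵥ : ∀ {n} j (u : Vertex n) → flipLow j u ≡ low j ⊕ᵥ u
flipLow≡low⊕ᵥ j u = tabulate-cong λ l → if-not≡xor (toℕ l <ᵇ j) (lookup u l)

-- Out of range the bit is junk (false); every use below has r < n.
bit : ∀ {n} → Vertex n → ℕ → Bool
bit []      _       = false
bit (b ∷ _) zero    = b
bit (_ ∷ u) (suc r) = bit u r

bit-⊕ᵥ : ∀ {n} (A : Mask) (u : Vertex n) {r} → r < n → bit (A ⊕ᵥ u) r ≡ A r xor bit u r
bit-⊕ᵥ A (b ∷ u) {zero}  _         = refl
bit-⊕ᵥ A (b ∷ u) {suc r} (s≤s r<n) = bit-⊕ᵥ (A ∘ suc) u r<n

transvection : ∀ {n} → ℕ → Mask → Vertex n → Vertex n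
transvection r C y = bit y r · C ⊕ᵥ y

transvection-⊕ᵥ : ∀ {n} r C A (y : Vertex n) → r < n →
  transvection r C (A ⊕ᵥ y) ≡ (A ⊕ A r · C) ⊕ᵥ transvection r C y
transvection-⊕ᵥ r C A y r<n = begin
  bit (A ⊕ᵥ y) r · C ⊕ᵥ A ⊕ᵥ y         ≡⟨ cong (λ b → b · C ⊕ᵥ A ⊕ᵥ y) (bit-⊕ᵥ A y r<n) ⟩
  (A r xor bit y r) · C ⊕ᵥ A ⊕ᵥ y      ≡⟨ ⊕ᵥ-assoc ((A r xor bit y r) · C) A y ⟩
  ((A r xor bit y r) · C ⊕ A) ⊕ᵥ y     ≡⟨ ⊕ᵥ-cong (λ p → shuffle (A r) (bit y r) (C p) (A p)) y ⟩
  (A ⊕ A r · C ⊕ bit y r · C) ⊕ᵥ y     ≡⟨ sym (⊕ᵥ-assoc (A ⊕ A r · C) (bit y r · C) y) ⟩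
  (A ⊕ A r · C) ⊕ᵥ bit y r · C ⊕ᵥ y    ∎
  where
  shuffle : ∀ a b c x → ((a xor b) ∧ c) xor x ≡ (x xor (a ∧ c)) xor (b ∧ c)
  shuffle a b c x = begin
    ((a xor b) ∧ c) xor x          ≡⟨ cong (_xor x) (∧-distribʳ-xor c a b) ⟩
    ((a ∧ c) xor (b ∧ c)) xor x    ≡⟨ xor-comm _ x ⟩
    x xor ((a ∧ c) xor (b ∧ c))    ≡⟨ sym (xor-assoc x _ _) ⟩
    (x xor (a ∧ c)) xor (b ∧ c)    ∎

transvection-fixes : ∀ {n} r C A (y : Vertex n) → r < n → A r ≡ false →
  transvection r C (A ⊕ᵥ y) ≡ A ⊕ᵥ transvection r C y
transvection-fixes r C A y r<n Ar≡false = trans (transvection-⊕ᵥ r C A y r<n)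
  (⊕ᵥ-cong (λ p → trans (cong (λ b → A p xor (b ∧ C p)) Ar≡false) (xor-identityʳ (A p))) (transvection r C y))

transvection-involutive : ∀ {n} r C (y : Vertex n) → r < n → C r ≡ false →
  transvection r C (transvection r C y) ≡ y
transvection-involutive r C y r<n Cr≡false = begin
  transvection r C (S ⊕ᵥ y)  ≡⟨ transvection-fixes r C S y r<n S-r≡false ⟩
  S ⊕ᵥ S ⊕ᵥ y               ≡⟨ ⊕ᵥ-involutive S y ⟩
  y                          ∎
  where
  S = bit y r · C
  S-r≡false : S r ≡ false
  S-r≡false = trans (cong (bit y r ∧_) Cr≡false) (∧-zeroʳ (bit y r))

linkMap : ∀ {n} → ℕ → ℕ → Vertex n → Vertex n
linkMap r j = transvection r (unit r ⊕ low j)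

linkMap-pivot : ∀ {n} r j (y : Vertex n) → r < n → linkMap r j (unit r ⊕ᵥ y) ≡ low j ⊕ᵥ linkMap r j y
linkMap-pivot r j y r<n =
  trans (transvection-⊕ᵥ r (unit r ⊕ low j) (unit r) y r<n) (⊕ᵥ-cong unit⊕pivot≗low (linkMap r j y))
  where
  unit⊕pivot≗low : unit r ⊕ unit r r · (unit r ⊕ low j) ≗ low j
  unit⊕pivot≗low p = trans (cong (λ b → (p ≡ᵇ r) xor (b ∧ ((p ≡ᵇ r) xor (p <ᵇ j)))) (≡ᵇ-refl r))
                           (xor-cancelˡ (p ≡ᵇ r) (p <ᵇ j))

linkMap-involutive : ∀ {n r j} (y : Vertex n) → r < j → r < n → linkMap r j (linkMap r j y) ≡ y
linkMap-involutive {r = r} {j} y r<j r<n = transvection-involutive r (unit r ⊕ low j) y r<n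
  (trans (cong (_xor (r <ᵇ j)) (≡ᵇ-refl r)) (cong not (<⇒<ᵇ-true r<j)))

-- A chain [(r₁ , j₁) , … , (r_k , j_k)] above b has b ≤ r₁ < j₁ ≤ r₂ < j₂ ≤ … ≤ n;
-- the r_i are bit positions and the j_i the paper's j₁ < … < j_k.
Chain : Set
Chain = List (ℕ × ℕ)

data IsChain (n : ℕ) : ℕ → Chain → Set where
  []   : ∀ {b} → IsChain n b []
  link : ∀ {b r j P} → b ≤ r → r < j → 2 ≤ j → j ≤ n → IsChain n j P → IsChain n b ((r , j) ∷ P)

starts ends : Chain → List ℕ
starts = List.map proj₁
ends   = List.map proj₂

link-bounds : ∀ {n b P r j} → IsChain n b P → (r , j) ∈ P → b ≤ r × r < j × 2 ≤ j × j ≤ n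
link-bounds (link b≤r r<j 2≤j j≤n _) (here refl) = b≤r , r<j , 2≤j , j≤n
link-bounds (link b≤r′ r′<j′ _ _ c) (there mem) =
  let (j′≤r , bounds) = link-bounds c mem
  in ≤-trans b≤r′ (≤-trans (<⇒≤ r′<j′) j′≤r) , bounds

∈-starts⁻ : ∀ {P i} → i ∈ starts P → ∃[ j ] (i , j) ∈ P
∈-starts⁻ i∈ with ∈-map⁻ proj₁ i∈
... | (_ , j) , mem , refl = j , mem

∈-ends⁻ : ∀ {P j} → j ∈ ends P → ∃[ r ] (r , j) ∈ P
∈-ends⁻ j∈ with ∈-map⁻ proj₂ j∈
... | (r , _) , mem , refl = r , mem

starts-bound : ∀ {n b P i} → IsChain n b P → i ∈ starts P → b ≤ i
starts-bound c i∈ = proj₁ (link-bounds c (proj₂ (∈-starts⁻ i∈)))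

ends-bound : ∀ {n b P j} → IsChain n b P → j ∈ ends P → b < j
ends-bound c j∈ = let (b≤r , r<j , _) = link-bounds c (proj₂ (∈-ends⁻ j∈)) in ≤-<-trans b≤r r<j

chainMap : ∀ {n} → Chain → Vertex n → Vertex n
chainMap []            y = y
chainMap ((r , j) ∷ P) y = chainMap P (linkMap r j y)

chainMap-injective : ∀ {n b P} → IsChain n b P → ∀ {x y : Vertex n} → chainMap P x ≡ chainMap P y → x ≡ y
chainMap-injective [] eq = eq
chainMap-injective {P = (r , j) ∷ P} (link _ r<j _ j≤n c) {x} {y} eq = begin
  x                            ≡⟨ sym (linkMap-involutive x r<j r<n) ⟩
  linkMap r j (linkMap r j x)  ≡⟨ cong (linkMap r j) (chainMap-injective c eq) ⟩
  linkMap r j (linkMap r j y)  ≡⟨ linkMap-involutive y r<j r<n ⟩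
  y                            ∎
  where r<n = <-≤-trans r<j j≤n

data Direction : Set where
  cube aug : ℕ → Direction

directionMask : Direction → Mask
directionMask (cube k) = unit k
directionMask (aug j)  = low j

ValidDirection : ℕ → Direction → Set
ValidDirection n (cube k) = k < n
ValidDirection n (aug j)  = 2 ≤ j × j ≤ n

direction : Chain → ℕ → Direction
direction []            k = cube k
direction ((r , j) ∷ P) k = if r ≡ᵇ k then aug j else direction P k

direction-cases : ∀ P k →
  (k ∉ starts P × direction P k ≡ cube k) ⊎ (∃[ j ] (k , j) ∈ P × direction P k ≡ aug j)
direction-cases []            k = inj₁ ((λ ()) , refl)
direction-cases ((r , j) ∷ P) k with r ≡ᵇ k in eq
... | true  = inj₂ (j , here (cong (_, j) (sym (≡ᵇ-true⇒≡ eq))) , refl)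
... | false with direction-cases P k
...   | inj₁ (k∉ , d≡)      = inj₁ ((λ { (here k≡r) → ≡ᵇ-false⇒≢ eq (sym k≡r) ; (there k∈) → k∉ k∈ }) , d≡)
...   | inj₂ (j′ , mem , d≡) = inj₂ (j′ , there mem , d≡)

direction-link : ∀ {n b P r j} → IsChain n b P → (r , j) ∈ P → direction P r ≡ aug j
direction-link {P = (r , j) ∷ P} (link _ _ _ _ _) (here refl) = cong (λ c → if c then aug j else direction P r) (≡ᵇ-refl r)
direction-link {P = (r′ , j′) ∷ P} {r} (link _ r′<j′ _ _ c) (there mem) =
  trans (cong (λ c → if c then aug j′ else direction P r) (≢⇒≡ᵇ-false r′≢r)) (direction-link c mem)
  where r′≢r = <⇒≢ (<-≤-trans r′<j′ (proj₁ (link-bounds c mem)))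

unlinked-direction : ∀ {P k} → k ∉ starts P → direction P k ≡ cube k
unlinked-direction {P} {k} k∉ with direction-cases P k
... | inj₁ (_ , d≡)       = d≡
... | inj₂ (_ , mem , _)  = contradiction (∈-map⁺ proj₁ mem) k∉

linked-direction≢cube : ∀ {P i k} → i ∈ starts P → direction P k ≢ cube i
linked-direction≢cube {P} {i} {k} i∈ eq with direction-cases P k
... | inj₁ (k∉ , d≡) with trans (sym d≡) eq
...   | refl = k∉ i∈
linked-direction≢cube {P} {i} {k} i∈ eq | inj₂ (_ , _ , d≡) with trans (sym d≡) eq
... | ()

aug-direction⇒end : ∀ {P k j} → direction P k ≡ aug j → j ∈ ends P
aug-direction⇒end {P} {k} eq with direction-cases P k
... | inj₁ (_ , d≡) with trans (sym d≡) eq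
...   | ()
aug-direction⇒end {P} {k} eq | inj₂ (_ , mem , d≡) with trans (sym d≡) eq
... | refl = ∈-map⁺ proj₂ mem

direction-valid : ∀ {n b P k} → IsChain n b P → k < n → ValidDirection n (direction P k)
direction-valid {P = P} {k} c k<n with direction-cases P k
... | inj₁ (_ , d≡)       rewrite d≡ = k<n
... | inj₂ (j , mem , d≡) rewrite d≡ = let (_ , _ , 2≤j , j≤n) = link-bounds c mem in 2≤j , j≤n

chainMap-low : ∀ {n b P j} → IsChain n b P → j ≤ b → (y : Vertex n) →
  chainMap P (low j ⊕ᵥ y) ≡ low j ⊕ᵥ chainMap P y
chainMap-low [] _ y = refl
chainMap-low {P = (r , j′) ∷ P} {j} (link b≤r r<j′ _ j′≤n c) j≤b y = trans
  (cong (chainMap P) (transvection-fixes r (unit r ⊕ low j′) (low j) y (<-≤-trans r<j′ j′≤n) (≤⇒<ᵇ-false j≤r)))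
  (chainMap-low c (≤-trans j≤r (<⇒≤ r<j′)) (linkMap r j′ y))
  where j≤r = ≤-trans j≤b b≤r

chainMap-unit : ∀ {n b P} → IsChain n b P → ∀ k (y : Vertex n) →
  chainMap P (unit k ⊕ᵥ y) ≡ directionMask (direction P k) ⊕ᵥ chainMap P y
chainMap-unit [] k y = refl
chainMap-unit {P = (r , j) ∷ P} (link _ r<j _ j≤n c) k y with r ≡ᵇ k in eq
... | true with ≡ᵇ-true⇒≡ {r} {k} eq
...   | refl = trans (cong (chainMap P) (linkMap-pivot r j y r<n)) (chainMap-low c ≤-refl (linkMap r j y))
  where r<n = <-≤-trans r<j j≤n
chainMap-unit {P = (r , j) ∷ P} (link _ r<j _ j≤n c) k y | false = trans
  (cong (chainMap P) (transvection-fixes r (unit r ⊕ low j) (unit k) y (<-≤-trans r<j j≤n) eq))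
  (chainMap-unit c k (linkMap r j y))

chainMap-flipAt : ∀ {n b P d} → IsChain n b P → ∀ i (u : Vertex n) → direction P (toℕ i) ≡ d →
  chainMap P (flipAt i u) ≡ directionMask d ⊕ᵥ chainMap P u
chainMap-flipAt {P = P} c i u refl = trans (cong (chainMap P) (flipAt≡unit⊕ᵥ i u)) (chainMap-unit c (toℕ i) u)

chainMap-edges : ∀ {n b P} → IsChain n b P → ∀ u v → QAdj n u v → AQAdj n (chainMap P u) (chainMap P v)
chainMap-edges {P = P} c u _ (i , refl) with direction-cases P (toℕ i)
... | inj₁ (_ , d≡) =
  inj₁ (i , trans (chainMap-flipAt c i u d≡) (sym (flipAt≡unit⊕ᵥ i (chainMap P u))))
... | inj₂ (j , mem , d≡) =
  let (_ , _ , 2≤j , j≤n) = link-bounds c mem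
  in inj₂ (j , 2≤j , j≤n , trans (chainMap-flipAt c i u d≡) (sym (flipLow≡low⊕ᵥ j (chainMap P u))))

chainCopy : ∀ {n b P} → IsChain n b P → QnCopy n
chainCopy {P = P} c = record { φ = chainMap P ; inj = chainMap-injective c ; edges = chainMap-edges c }

unit≢low : ∀ {n} k j → 2 ≤ j → j ≤ n → ¬ (∀ {p} → p < n → unit k p ≡ low j p)
unit≢low zero    j 2≤j j≤n same =
  contradiction (trans (same (<-≤-trans 2≤j j≤n)) (<⇒<ᵇ-true 2≤j)) λ ()
unit≢low (suc k) j 2≤j j≤n same =
  contradiction (trans (same 0<n) (<⇒<ᵇ-true 0<j)) λ ()
  where
  0<j = ≤-trans (s≤s z≤n) 2≤j
  0<n = <-≤-trans 0<j j≤n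

low≢low : ∀ {n} j j′ → j < j′ → j′ ≤ n → ¬ (∀ {p} → p < n → low j p ≡ low j′ p)
low≢low j j′ j<j′ j′≤n same =
  contradiction (trans (sym (≤⇒<ᵇ-false {j} {j} ≤-refl)) (trans (same (<-≤-trans j<j′ j′≤n)) (<⇒<ᵇ-true j<j′))) λ ()

directionMask-injective : ∀ {n d d′} → ValidDirection n d → ValidDirection n d′ →
  (∀ {p} → p < n → directionMask d p ≡ directionMask d′ p) → d ≡ d′
directionMask-injective {d = cube k} {cube k′} k<n _ same =
  cong cube (≡ᵇ-true⇒≡ (trans (sym (same k<n)) (≡ᵇ-refl k)))
directionMask-injective {d = cube k} {aug j} _ (2≤j , j≤n) same = ⊥-elim (unit≢low k j 2≤j j≤n same)
directionMask-injective {d = aug j} {cube k} (2≤j , j≤n) _ same = ⊥-elim (unit≢low k j 2≤j j≤n (sym ∘ same))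
directionMask-injective {d = aug j} {aug j′} (_ , j≤n) (_ , j′≤n) same with <-cmp j j′
... | tri< j<j′ _ _ = ⊥-elim (low≢low j j′ j<j′ j′≤n same)
... | tri≈ _ refl _ = refl
... | tri> _ _ j′<j = ⊥-elim (low≢low j′ j j′<j j≤n (sym ∘ same))

HasDirection : ℕ → Chain → Direction → Set
HasDirection n P d = ∃[ k ] k < n × direction P k ≡ d

-- The image under P of one cube edge of direction d is an edge of Q's image, so its
-- endpoints differ by the mask of some direction of Q; distinct valid directions have
-- distinct masks.
image-directions : ∀ {n b b′ P Q d} (cP : IsChain n b P) (cQ : IsChain n b′ Q) →
  (∀ x y → ImgEdge (chainCopy cP) x y → ImgEdge (chainCopy cQ) x y) →
  HasDirection n P d → HasDirection n Q d
image-directions {n} {P = P} {Q} cP cQ ⊆ (k , k<n , refl) =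
  from-edge (⊆ _ _ (w , flipAt i₀ w , (i₀ , refl) , refl , refl))
  where
  w  = replicate n false
  i₀ = fromℕ< k<n
  from-edge : ImgEdge (chainCopy cQ) (chainMap P w) (chainMap P (flipAt i₀ w)) → HasDirection n Q (direction P k)
  from-edge (u , _ , (i , refl) , φu≡ , φv≡) =
    toℕ i , toℕ<n i ,
    directionMask-injective (direction-valid cQ (toℕ<n i)) (direction-valid cP k<n)
      (⊕ᵥ-cancelʳ (directionMask dQ) (directionMask (direction P k)) (chainMap P w) (begin
        directionMask dQ ⊕ᵥ chainMap P w               ≡⟨ cong (directionMask dQ ⊕ᵥ_) (sym φu≡) ⟩
        directionMask dQ ⊕ᵥ chainMap Q u               ≡⟨ sym (chainMap-flipAt cQ i u refl) ⟩
        chainMap Q (flipAt i u)                         ≡⟨ φv≡ ⟩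
        chainMap P (flipAt i₀ w)                        ≡⟨ chainMap-flipAt cP i₀ w (cong (direction P) (toℕ-fromℕ< k<n)) ⟩
        directionMask (direction P k) ⊕ᵥ chainMap P w  ∎))
    where dQ = direction Q (toℕ i)

Separated : Chain → Chain → Set
Separated P Q = (∃[ i ] i ∈ starts P × i ∉ starts Q) ⊎ (∃[ j ] j ∈ ends P × j ∉ ends Q)

Apart : Chain → Chain → Set
Apart P Q = Separated P Q ⊎ Separated Q P

Apart-sym : Symmetric Apart
Apart-sym = swap

separated⇒distinct : ∀ {n b b′ P Q} (cP : IsChain n b P) (cQ : IsChain n b′ Q) →
  Separated P Q → DistinctSubgraphs (chainCopy cP) (chainCopy cQ)
separated⇒distinct cP cQ (inj₁ (i , i∈P , i∉Q)) same =
  let (j , mem) = ∈-starts⁻ i∈P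
      (_ , i<j , _ , j≤n) = link-bounds cP mem
      (_ , _ , d≡) = image-directions cQ cP (λ x y → Equivalence.from (same x y))
                       (i , <-≤-trans i<j j≤n , unlinked-direction i∉Q)
  in linked-direction≢cube i∈P d≡
separated⇒distinct cP cQ (inj₂ (j , j∈P , j∉Q)) same =
  let (r , mem) = ∈-ends⁻ j∈P
      (_ , r<j , _ , j≤n) = link-bounds cP mem
      (_ , _ , d≡) = image-directions cP cQ (λ x y → Equivalence.to (same x y))
                       (r , <-≤-trans r<j j≤n , direction-link cP mem)
  in j∉Q (aug-direction⇒end d≡)

apart⇒distinct : ∀ {n b b′ P Q} (cP : IsChain n b P) (cQ : IsChain n b′ Q) →
  Apart P Q → DistinctSubgraphs (chainCopy cP) (chainCopy cQ)
apart⇒distinct cP cQ (inj₁ sep) = separated⇒distinct cP cQ sep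
apart⇒distinct cP cQ (inj₂ sep) same = separated⇒distinct cQ cP sep (λ x y → ⇔-sym (same x y))

separated-∷ : ∀ {n r x P Q} → r < x → IsChain n x P → Separated P Q → Separated ((r , x) ∷ P) ((r , x) ∷ Q)
separated-∷ r<x cP (inj₁ (i , i∈P , i∉Q)) = inj₁ (i , there i∈P , λ
  { (here i≡r)  → <⇒≱ r<x (subst (_ ≤_) i≡r (starts-bound cP i∈P))
  ; (there i∈Q) → i∉Q i∈Q })
separated-∷ r<x cP (inj₂ (j , j∈P , j∉Q)) = inj₂ (j , there j∈P , λ
  { (here j≡x)  → <-irrefl (sym j≡x) (ends-bound cP j∈P)
  ; (there j∈Q) → j∉Q j∈Q })

Apart-∷ : ∀ {n r x P Q} → r < x → IsChain n x P → IsChain n x Q → Apart P Q → Apart ((r , x) ∷ P) ((r , x) ∷ Q)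
Apart-∷ r<x cP cQ = ⊎-map (separated-∷ r<x cP) (separated-∷ r<x cQ)

range : ℕ → ℕ → List ℕ
range a b = applyUpTo (a +_) (b ∸ a)

range-bounds : ∀ a b → All (λ r → a ≤ r × r < b) (range a b)
range-bounds a b = All.applyUpTo⁺₁ _ (b ∸ a) λ {i} i<b∸a → m≤m+n a i , m<n∸o⇒o+m<n a b i<b∸a

range-increasing : ∀ a b → AllPairs _<_ (range a b)
range-increasing a b = AllPairs.applyUpTo⁺₁ _ (b ∸ a) λ i<j _ → +-monoʳ-< a i<j

extend : ℕ → ℕ → List Chain → List Chain
extend b x S = concatMap (λ r → List.map ((r , x) ∷_) S) (range b x)

All-extend : ∀ b x S {Pr : Chain → Set} →
  (∀ {r P} → b ≤ r → r < x → P ∈ S → Pr ((r , x) ∷ P)) → All Pr (extend b x S)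
All-extend b x S h =
  All.concat⁺ (All.map⁺ (All.map (λ (b≤r , r<x) → All.map⁺ (All.tabulate (h b≤r r<x))) (range-bounds b x)))

length-extend : ∀ b x S → length (extend b x S) ≡ (x ∸ b) * length S
length-extend b x S = trans (blocks (range b x)) (cong (_* length S) (length-applyUpTo (b +_) (x ∸ b)))
  where
  blocks : ∀ rs → length (concatMap (λ r → List.map ((r , x) ∷_) S) rs) ≡ length rs * length S
  blocks []       = refl
  blocks (r ∷ rs) = trans (length-++ (List.map ((r , x) ∷_) S)) (cong₂ _+_ (length-map _ S) (blocks rs))

extend-apart : ∀ {n} b x S → All (IsChain n x) S → AllPairs Apart S → AllPairs Apart (extend b x S)
extend-apart {n} b x S cS apS = AllPairs.concat⁺
  (All.map⁺ (All.map (λ (_ , r<x) → AllPairs.map⁺ (AllPairs.map (λ (cP , cQ , ap) → Apart-∷ r<x cP cQ ap) (AllPairs-with cS apS)))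
                     (range-bounds b x)))
  (AllPairs.map⁺ (AllPairs.map different-starts (AllPairs-with (range-bounds b x) (range-increasing b x))))
  where
  different-starts : ∀ {r r′} → (b ≤ r × r < x) × (b ≤ r′ × r′ < x) × r < r′ →
    All (λ P → All (Apart P) (List.map ((r′ , x) ∷_) S)) (List.map ((r , x) ∷_) S)
  different-starts {r} {r′} ((_ , r<x) , _ , r<r′) =
    All.map⁺ (All.tabulate λ _ → All.map⁺ (All.map (λ cQ → inj₁ (inj₁ (r , here refl , r∉ cQ))) cS))
    where
    r∉ : ∀ {Q} → IsChain n x Q → r ∉ r′ ∷ starts Q
    r∉ cQ (here r≡r′)  = <⇒≢ r<r′ r≡r′
    r∉ cQ (there r∈Q) = <⇒≱ r<x (starts-bound cQ r∈Q)

-- The chains above b whose ends form a sublist of L.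
chains : ℕ → List ℕ → List Chain
chains b []       = [] ∷ []
chains b (x ∷ xs) = chains b xs ++ extend b x (chains x xs)

chains-valid : ∀ {n} b {L} → All (λ j → 2 ≤ j × j ≤ n) L → All (IsChain n b) (chains b L)
chains-valid b []                          = [] ∷ []
chains-valid b {x ∷ xs} ((2≤x , x≤n) ∷ bounds) = All.++⁺ (chains-valid b bounds)
  (All-extend b x (chains x xs) λ b≤r r<x P∈ → link b≤r r<x 2≤x x≤n (All.lookup (chains-valid x bounds) P∈))

chains-ends : ∀ b L → All (λ P → All (_∈ L) (ends P)) (chains b L)
chains-ends b []       = [] ∷ []
chains-ends b (x ∷ xs) = All.++⁺ (All.map (All.map there) (chains-ends b xs))
  (All-extend b x (chains x xs) λ _ _ P∈ → here refl ∷ All.map there (All.lookup (chains-ends x xs) P∈))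

chains-apart : ∀ {n} b {L} → AllPairs _<_ L → All (λ j → 2 ≤ j × j ≤ n) L → AllPairs Apart (chains b L)
chains-apart b []                    []             = [] ∷ []
chains-apart b {x ∷ xs} (x<xs ∷ inc) (_ ∷ bounds) = AllPairs.++⁺
  (chains-apart b inc bounds)
  (extend-apart b x (chains x xs) (chains-valid x bounds) (chains-apart x inc bounds))
  (All.map (λ ends⊆xs → All-extend b x (chains x xs) λ _ _ _ → inj₂ (inj₂ (x , here refl , x∉ ends⊆xs))) (chains-ends b xs))
  where
  x∉ : ∀ {P} → All (_∈ xs) (ends P) → x ∉ ends P
  x∉ ends⊆xs x∈P = <-irrefl refl (All.lookup x<xs (All.lookup ends⊆xs x∈P))

-- The number of chains above b with ends s = j₁ … j_k: (j₁ - b) (j₂ - j₁) ⋯ (j_k - j_{k-1}).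
weight : ℕ → List ℕ → ℕ
weight b []       = 1
weight b (x ∷ xs) = (x ∸ b) * weight x xs

sum-sublists-∷ : ∀ (h : List ℕ → ℕ) x xs →
  sum (List.map h (sublists (x ∷ xs))) ≡ sum (List.map h (sublists xs)) + sum (List.map (h ∘ (x ∷_)) (sublists xs))
sum-sublists-∷ h x xs = begin
  sum (List.map h (sublists xs ++ List.map (x ∷_) (sublists xs)))
    ≡⟨ cong sum (map-++ h (sublists xs) _) ⟩
  sum (List.map h (sublists xs) ++ List.map h (List.map (x ∷_) (sublists xs)))
    ≡⟨ sum-++ (List.map h (sublists xs)) _ ⟩
  sum (List.map h (sublists xs)) + sum (List.map h (List.map (x ∷_) (sublists xs)))
    ≡⟨ cong (λ t → _ + sum t) (sym (map-∘ (sublists xs))) ⟩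
  sum (List.map h (sublists xs)) + sum (List.map (h ∘ (x ∷_)) (sublists xs)) ∎

length-chains : ∀ b L → length (chains b L) ≡ sum (List.map (weight b) (sublists L))
length-chains b []       = refl
length-chains b (x ∷ xs) = begin
  length (chains b xs ++ extend b x (chains x xs))
    ≡⟨ length-++ (chains b xs) ⟩
  length (chains b xs) + length (extend b x (chains x xs))
    ≡⟨ cong₂ _+_ (length-chains b xs) (length-extend b x (chains x xs)) ⟩
  sum (List.map (weight b) (sublists xs)) + (x ∸ b) * length (chains x xs)
    ≡⟨ cong (λ t → _ + (x ∸ b) * t) (length-chains x xs) ⟩
  sum (List.map (weight b) (sublists xs)) + (x ∸ b) * sum (List.map (weight x) (sublists xs))
    ≡⟨ cong (_ +_) (sym (sum-map-*ˡ (x ∸ b) (weight x) (sublists xs))) ⟩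
  sum (List.map (weight b) (sublists xs)) + sum (List.map (weight b ∘ (x ∷_)) (sublists xs))
    ≡⟨ sym (sum-sublists-∷ (weight b) x xs) ⟩
  sum (List.map (weight b) (sublists (x ∷ xs))) ∎

weight≡diffProd : ∀ j s → weight j s ≡ diffProd (j ∷ s)
weight≡diffProd j []      = refl
weight≡diffProd j (k ∷ s) = cong ((k ∸ j) *_) (weight≡diffProd k s)

weight-0≡term : ∀ j s → weight 0 (j ∷ s) ≡ term (j ∷ s)
weight-0≡term j s = trans (*-comm j (weight j s)) (cong (_* j) (weight≡diffProd j s))

sum-weight-0 : ∀ L → sum (List.map (weight 0) (sublists L)) ≡ 1 + sum (List.map term (sublists L))
sum-weight-0 []       = refl
sum-weight-0 (x ∷ xs) = begin
  sum (List.map (weight 0) (sublists (x ∷ xs)))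
    ≡⟨ sum-sublists-∷ (weight 0) x xs ⟩
  sum (List.map (weight 0) (sublists xs)) + sum (List.map (weight 0 ∘ (x ∷_)) (sublists xs))
    ≡⟨ cong₂ _+_ (sum-weight-0 xs) (cong sum (map-cong (weight-0≡term x) (sublists xs))) ⟩
  1 + (sum (List.map term (sublists xs)) + sum (List.map (term ∘ (x ∷_)) (sublists xs)))
    ≡⟨ cong (1 +_) (sym (sum-sublists-∷ term x xs)) ⟩
  1 + sum (List.map term (sublists (x ∷ xs))) ∎

from2-bounds : ∀ n → All (λ j → 2 ≤ j × j ≤ n) (from2 n)
from2-bounds n = All.map⁺ (All.applyUpTo⁺₁ _ (n ∸ 1) λ {i} i<n∸1 →
  m≤n+m 2 i , subst (_≤ n) (+-comm 2 i) (m<n∸o⇒o+m<n 1 n i<n∸1))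

from2-increasing : ∀ n → AllPairs _<_ (from2 n)
from2-increasing n = AllPairs.map⁺ (AllPairs.applyUpTo⁺₁ _ (n ∸ 1) λ i<j _ → +-monoˡ-< 2 i<j)

count : ∀ n → length (chains 0 (from2 n)) ≡ f n
count n = trans (length-chains 0 (from2 n)) (sum-weight-0 (from2 n))

DistinctCopies : ℕ → ℕ → Set
DistinctCopies n m = Σ (Fin m → QnCopy n) λ copies → ∀ (i j : Fin m) → i ≢ j → DistinctSubgraphs (copies i) (copies j)

distinctCopies : ∀ {n b} (Cs : List Chain) → All (IsChain n b) Cs → AllPairs Apart Cs → DistinctCopies n (length Cs)
distinctCopies {n} {b} Cs valid apart =
  (λ i → chainCopy (valid-at i)) ,
  λ i j i≢j → apart⇒distinct (valid-at i) (valid-at j) (AllPairs-lookup Apart-sym apart i≢j)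
  where
  valid-at : (i : Fin (length Cs)) → IsChain n b (List.lookup Cs i)
  valid-at i = All.lookup valid (∈-lookup i)

-- The construction works for every n.
theorem3p1 : (n : ℕ) → 2 ≤ n →
    Σ (Fin (f n) → QnCopy n) λ copies →
      ∀ (i j : Fin (f n)) → i ≢ j →
        DistinctSubgraphs (copies i) (copies j)
theorem3p1 n _ = subst (DistinctCopies n) (count n)
  (distinctCopies (chains 0 (from2 n)) (chains-valid 0 (from2-bounds n)) (chains-apart 0 (from2-increasing n) (from2-bounds n)))
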